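{- If a $(v,k,\lambda)$-BIBD admits a $0$-ULSE $\ell$-colouring with $\ell<v$, then \[\frac{3+\sqrt{4k+1}}{2}\leq \ell\leq \frac{k}{2}+1.\]
   Context: For positive integers $v,k,\lambda$ with $2\le k<v$, a $(v,k,\lambda)$-BIBD is a pair $(V,\mathcal{B})$ where $V$ is a set of $v$ points and $\mathcal{B}$ is a collection of $k$-element subsets of $V$ (blocks) such that every pair of distinct points lies in exactly $\lambda$ blocks. An $\ell$-colouring is a surjective map from $V$ onto a set of $\ell$ colours. A $0$-ULSE $\ell$-colouring is an $\ell$-colouring such that $(\ell-1)$ divides $k$ and in every block exactly one colour does not appear, while each of the other $\ell-1$ colours appears exactly $\frac{k}{\ell-1}$ times in that block. It is nontrivial if $\ell<v$. -}

module Defs where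

open import Data.Nat using (ℕ; _≤_; _<_; _∸_)
open import Data.Nat.Divisibility using (_∣_; module _∣_)
open import Data.Fin using (Fin; _≟_)
open import Data.Fin.Subset using (Subset; _∈_; ∣_∣)
open import Data.Fin.Subset.Properties using (_∈?_)
open import Data.List using (List; length; filter; allFin)
open import Data.List.Membership.Propositional using () renaming (_∈_ to _∈ₗ_)
open import Data.Product using (Σ; _×_; ∃)
open import Relation.Binary.PropositionalEquality using (_≡_)
open import Relation.Nullary using (¬_)
open import Relation.Nullary.Decidable using (_×-dec_)

-- Points are Fin v; a block is a subset of the points; the collection of
-- blocks is a list (so repeated blocks are allowed).

pairCount : {v : ℕ} → List (Subset v) → Fin v → Fin v → ℕ
pairCount ℬ x y = length (filter (λ B → (x ∈? B) ×-dec (y ∈? B)) ℬ)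

record IsBIBD (v k λ' : ℕ) (ℬ : List (Subset v)) : Set where
  field
    two≤k       : 2 ≤ k
    k<v         : k < v
    λ-positive  : 1 ≤ λ'
    blockSize   : ∀ {B} → B ∈ₗ ℬ → ∣ B ∣ ≡ k
    balanced    : ∀ (x y : Fin v) → ¬ (x ≡ y) → pairCount ℬ x y ≡ λ'

-- an ℓ-colouring: a surjective map from the points onto Fin ℓ
Surjective : {v ℓ : ℕ} → (Fin v → Fin ℓ) → Set
Surjective {v} {ℓ} c = ∀ (j : Fin ℓ) → ∃ λ (x : Fin v) → c x ≡ j

colourCount : {v ℓ : ℕ} → (Fin v → Fin ℓ) → Subset v → Fin ℓ → ℕ
colourCount {v} c B i = length (filter (λ x → (x ∈? B) ×-dec (c x ≟ i)) (allFin v))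

record IsZeroULSE (v k ℓ : ℕ) (ℬ : List (Subset v)) (c : Fin v → Fin ℓ) : Set where
  field
    surjective : Surjective c
    divides    : (ℓ ∸ 1) ∣ k
    perBlock   : ∀ {B} → B ∈ₗ ℬ →
                 Σ (Fin ℓ) λ j →
                   (colourCount c B j ≡ 0) ×
                   (∀ (i : Fin ℓ) → ¬ (i ≡ j) →
                      colourCount c B i ≡ _∣_.quotient divides)

-- Write r for the number of blocks through a point x, q = k/(ℓ-1) and n for the size
-- of the colour class of x. Counting the pairs (y, B) with x, y ∈ B, once over all
-- points y and once over the points y of the colour of x, gives
--   r(k-1) = λ(v-1)   and   r(q-1) = λ(n-1),
-- the second because a block through x misses some colour other than that of x and so
-- contains exactly q points of it. If q = 1 then every colour class is a single point
-- and ℓ = v; hence q ≥ 2, which is 2ℓ ≤ k+2. Taking x in a smallest class, ℓn ≤ v,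
-- and the two identities force q < ℓ-1, so 4k+1 = 4q(ℓ-1)+1 ≤ (2ℓ-3)².
module Submission where

open import Defs
open import Data.Bool.Base using (true; false; if_then_else_)
open import Data.Nat.Base using (ℕ; zero; suc; _+_; _*_; _∸_; _^_; _≤_; _<_; s≤s; >-nonZero)
open import Data.Nat.Properties hiding (_≟_)
open import Data.Nat.Divisibility using (module _∣_)
open import Data.Nat.Tactic.RingSolver using (solve-∀)
open import Data.Fin.Base using (Fin; punchIn) renaming (zero to fzero; suc to fsuc)
open import Data.Fin using (_≟_)
open import Data.Fin.Properties using (punchInᵢ≢i)
open import Data.Fin.Subset using (Subset; _∈_; ∣_∣; inside; outside)
open import Data.Fin.Subset.Properties using (_∈?_)
open import Data.List.Base using (List; length; filter; tabulate; lookup)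
open import Data.List.Properties using (tabulate-lookup)
open import Data.List.Membership.Propositional using () renaming (_∈_ to _∈ₗ_)
open import Data.List.Membership.Propositional.Properties using (∈-lookup; ∈-length; ∈-filter⁺; ∈-allFin)
open import Data.Vec.Base using (_∷_; [])
open import Data.Product.Base using (_×_; _,_; ∃)
open import Function.Base using (_∘_; id)
open import Relation.Nullary using (Dec; does; yes; no; ¬_; contradiction)
open import Relation.Nullary.Decidable using (_×-dec_)
open import Relation.Unary using (Pred; Decidable)
open import Relation.Binary.PropositionalEquality
open import Algebra.Properties.Semiring.Sum +-*-semiring
  using (sum-syntax; sum-cong-≗; sum-remove; sum-replicate-zero; ∑-comm; *-distribˡ-sum; *-distribʳ-sum)

𝟙[_] : ∀ {p} {P : Set p} → Dec P → ℕ
𝟙[ d ] = if does d then 1 else 0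

module _ {p} {P : Set p} where

  𝟙-yes : (d : Dec P) → P → 𝟙[ d ] ≡ 1
  𝟙-yes (yes _) _  = refl
  𝟙-yes (no ¬p) p = contradiction p ¬p

  𝟙-no : (d : Dec P) → ¬ P → 𝟙[ d ] ≡ 0
  𝟙-no (yes p) ¬p = contradiction p ¬p
  𝟙-no (no _)  _  = refl

  𝟙-*-cong : (d : Dec P) {m n : ℕ} → (P → m ≡ n) → 𝟙[ d ] * m ≡ 𝟙[ d ] * n
  𝟙-*-cong (yes p) m≡n = cong (_+ 0) (m≡n p)
  𝟙-*-cong (no _)  _   = refl

  𝟙-×-dec-diag : (d : Dec P) → 𝟙[ d ×-dec d ] ≡ 𝟙[ d ]
  𝟙-×-dec-diag (yes _) = refl
  𝟙-×-dec-diag (no _)  = refl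

𝟙-×-dec : ∀ {p q} {P : Set p} {Q : Set q} (d : Dec P) (e : Dec Q) → 𝟙[ d ×-dec e ] ≡ 𝟙[ d ] * 𝟙[ e ]
𝟙-×-dec (yes _) (yes _) = refl
𝟙-×-dec (yes _) (no _)  = refl
𝟙-×-dec (no _)  _       = refl

∑-1 : ∀ n → ∑[ i < n ] 1 ≡ n
∑-1 zero    = refl
∑-1 (suc n) = cong suc (∑-1 n)

∑-𝟙-≟ : ∀ {n} (j : Fin n) → ∑[ i < n ] 𝟙[ j ≟ i ] ≡ 1
∑-𝟙-≟ {suc n} j = begin
  ∑[ i < suc n ] 𝟙[ j ≟ i ]                    ≡⟨ sum-remove {i = j} (λ i → 𝟙[ j ≟ i ]) ⟩
  𝟙[ j ≟ j ] + ∑[ i < n ] 𝟙[ j ≟ punchIn j i ]  ≡⟨ cong₂ _+_ (𝟙-yes (j ≟ j) refl) off-diagonal ⟩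
  1                                             ∎
  where
  open ≡-Reasoning
  off-diagonal : ∑[ i < n ] 𝟙[ j ≟ punchIn j i ] ≡ 0
  off-diagonal = trans (sum-cong-≗ (λ i → 𝟙-no (j ≟ punchIn j i) (punchInᵢ≢i j i ∘ sym)))
                       (sum-replicate-zero n)

∃-≤-average : ∀ {n} (f : Fin (suc n) → ℕ) → ∃ λ i → suc n * f i ≤ ∑[ j < suc n ] f j
∃-≤-average {zero}  f = fzero , ≤-refl
∃-≤-average {suc n} f with ∃-≤-average (f ∘ fsuc)
... | i , hi with f (fsuc i) ≤? f fzero
...   | yes fi≤f0 = fsuc i , +-mono-≤ fi≤f0 hi
...   | no  fi≰f0 = fzero , +-monoʳ-≤ (f fzero) (≤-trans (*-monoʳ-≤ (suc n) (<⇒≤ (≰⇒> fi≰f0))) hi)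

∑-off-diagonal : ∀ {n} (x : Fin n) (f g : Fin n → ℕ) {a} → (∀ y → ¬ x ≡ y → f y ≡ g y * a) →
                 ∑[ y < n ] f y + g x * a ≡ f x + (∑[ y < n ] g y) * a
∑-off-diagonal {suc n} x f g {a} f≡ga = begin
  ∑[ y < suc n ] f y + g x * a
    ≡⟨ cong (_+ g x * a) (sum-remove {i = x} f) ⟩
  f x + ∑[ i < n ] f (punchIn x i) + g x * a
    ≡⟨ cong (λ s → f x + s + g x * a) (sum-cong-≗ λ i → f≡ga (punchIn x i) (punchInᵢ≢i x i ∘ sym)) ⟩
  f x + ∑[ i < n ] (g (punchIn x i) * a) + g x * a
    ≡⟨ cong (λ s → f x + s + g x * a) (sym (*-distribʳ-sum a (g ∘ punchIn x))) ⟩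
  f x + (∑[ i < n ] g (punchIn x i)) * a + g x * a
    ≡⟨ regroup (f x) (∑[ i < n ] g (punchIn x i)) (g x) a ⟩
  f x + (g x + ∑[ i < n ] g (punchIn x i)) * a
    ≡⟨ cong (λ s → f x + s * a) (sym (sum-remove {i = x} g)) ⟩
  f x + (∑[ y < suc n ] g y) * a ∎
  where
  open ≡-Reasoning
  regroup : ∀ b s c a → b + s * a + c * a ≡ b + (c + s) * a
  regroup = solve-∀

length-filter-tabulate : ∀ {a p} {A : Set a} {P : Pred A p} (P? : Decidable P) {n} (f : Fin n → A) →
                         length (filter P? (tabulate f)) ≡ ∑[ i < n ] 𝟙[ P? (f i) ]
length-filter-tabulate P? {zero}  f = refl
length-filter-tabulate P? {suc n} f with does (P? (f fzero))
... | true  = cong suc (length-filter-tabulate P? (f ∘ fsuc))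
... | false = length-filter-tabulate P? (f ∘ fsuc)

length-filter-lookup : ∀ {a p} {A : Set a} {P : Pred A p} (P? : Decidable P) (xs : List A) →
                       length (filter P? xs) ≡ ∑[ i < length xs ] 𝟙[ P? (lookup xs i) ]
length-filter-lookup P? xs = trans (cong (length ∘ filter P?) (sym (tabulate-lookup xs)))
                                   (length-filter-tabulate P? (lookup xs))

∣∣≡∑∈ : ∀ {n} (B : Subset n) → ∣ B ∣ ≡ ∑[ y < n ] 𝟙[ y ∈? B ]
∣∣≡∑∈ []            = refl
∣∣≡∑∈ (inside ∷ B)  = cong suc (∣∣≡∑∈ B)
∣∣≡∑∈ (outside ∷ B) = ∣∣≡∑∈ B

module Incidence {v : ℕ} (ℬ : List (Subset v)) where

  open ≡-Reasoning

  block : Fin (length ℬ) → Subset v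
  block = lookup ℬ

  replication : Fin v → ℕ
  replication x = ∑[ j < length ℬ ] 𝟙[ x ∈? block j ]

  pairCount≡∑ : ∀ x y → pairCount ℬ x y ≡ ∑[ j < length ℬ ] (𝟙[ x ∈? block j ] * 𝟙[ y ∈? block j ])
  pairCount≡∑ x y = trans (length-filter-lookup _ ℬ) (sum-cong-≗ λ j → 𝟙-×-dec (x ∈? block j) (y ∈? block j))

  pairCount-diag : ∀ x → pairCount ℬ x x ≡ replication x
  pairCount-diag x = trans (length-filter-lookup _ ℬ) (sum-cong-≗ λ j → 𝟙-×-dec-diag (x ∈? block j))

  double-count : ∀ x (g : Fin v → ℕ) →
                 ∑[ y < v ] (g y * pairCount ℬ x y) ≡
                 ∑[ j < length ℬ ] (𝟙[ x ∈? block j ] * ∑[ y < v ] (𝟙[ y ∈? block j ] * g y))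
  double-count x g = begin
    ∑[ y < v ] (g y * pairCount ℬ x y)
      ≡⟨ sum-cong-≗ (λ y → trans (cong (g y *_) (pairCount≡∑ x y)) (*-distribˡ-sum (g y) (incidence y))) ⟩
    ∑[ y < v ] ∑[ j < length ℬ ] (g y * incidence y j)
      ≡⟨ ∑-comm (λ y j → g y * incidence y j) ⟩
    ∑[ j < length ℬ ] ∑[ y < v ] (g y * incidence y j)
      ≡⟨ sum-cong-≗ (λ j → trans (sum-cong-≗ λ y → reassoc (g y) 𝟙[ x ∈? block j ] 𝟙[ y ∈? block j ])
                                 (sym (*-distribˡ-sum 𝟙[ x ∈? block j ] (λ y → 𝟙[ y ∈? block j ] * g y)))) ⟩
    ∑[ j < length ℬ ] (𝟙[ x ∈? block j ] * ∑[ y < v ] (𝟙[ y ∈? block j ] * g y)) ∎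
    where
    incidence : Fin v → Fin (length ℬ) → ℕ
    incidence y j = 𝟙[ x ∈? block j ] * 𝟙[ y ∈? block j ]
    reassoc : ∀ a b c → a * (b * c) ≡ b * (c * a)
    reassoc = solve-∀

  weighted-pairCount : ∀ {λ'} x → (∀ y → ¬ x ≡ y → pairCount ℬ x y ≡ λ') → ∀ (g : Fin v → ℕ) →
                       ∑[ y < v ] (g y * pairCount ℬ x y) + g x * λ' ≡ g x * replication x + λ' * ∑[ y < v ] g y
  weighted-pairCount {λ'} x balanced g = begin
    ∑[ y < v ] (g y * pairCount ℬ x y) + g x * λ'
      ≡⟨ ∑-off-diagonal x (λ y → g y * pairCount ℬ x y) g (λ y x≢y → cong (g y *_) (balanced y x≢y)) ⟩
    g x * pairCount ℬ x x + (∑[ y < v ] g y) * λ'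
      ≡⟨ cong₂ _+_ (cong (g x *_) (pairCount-diag x)) (*-comm (∑[ y < v ] g y) λ') ⟩
    g x * replication x + λ' * ∑[ y < v ] g y ∎

  replication-identity : ∀ {λ' s} x → (∀ y → ¬ x ≡ y → pairCount ℬ x y ≡ λ') →
                         (g : Fin v → ℕ) → g x ≡ 1 →
                         (∀ j → x ∈ block j → ∑[ y < v ] (𝟙[ y ∈? block j ] * g y) ≡ s) →
                         replication x * s + λ' ≡ replication x + λ' * ∑[ y < v ] g y
  replication-identity {λ'} {s} x balanced g gx≡1 weight = begin
    replication x * s + λ'
      ≡⟨ cong₂ _+_ (*-distribʳ-sum s (λ j → 𝟙[ x ∈? block j ])) (sym gx*λ'≡λ') ⟩
    ∑[ j < length ℬ ] (𝟙[ x ∈? block j ] * s) + g x * λ'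
      ≡⟨ cong (_+ g x * λ') (sum-cong-≗ λ j → 𝟙-*-cong (x ∈? block j) (sym ∘ weight j)) ⟩
    ∑[ j < length ℬ ] (𝟙[ x ∈? block j ] * ∑[ y < v ] (𝟙[ y ∈? block j ] * g y)) + g x * λ'
      ≡⟨ cong (_+ g x * λ') (sym (double-count x g)) ⟩
    ∑[ y < v ] (g y * pairCount ℬ x y) + g x * λ'
      ≡⟨ weighted-pairCount x balanced g ⟩
    g x * replication x + λ' * ∑[ y < v ] g y
      ≡⟨ cong (λ a → a * replication x + λ' * ∑[ y < v ] g y) gx≡1 ⟩
    1 * replication x + λ' * ∑[ y < v ] g y
      ≡⟨ cong (_+ λ' * ∑[ y < v ] g y) (*-identityˡ (replication x)) ⟩
    replication x + λ' * ∑[ y < v ] g y ∎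
    where
    gx*λ'≡λ' : g x * λ' ≡ λ'
    gx*λ'≡λ' = trans (cong (_* λ') gx≡1) (*-identityˡ λ')

-- r(qm-1) = λ(v-1) and r(q-1) = λ(n-1) without truncated subtraction.
quotient<m : ∀ {r q m l n v} → 1 ≤ m → 1 ≤ l →
             r * (q * m) + l ≡ r + l * v → r * q + l ≡ r + l * n → suc m * n ≤ v → q < m
quotient<m {r} {q} {m} {l} {n} {v} 1≤m 1≤l replication-eq class-eq m+1*n≤v =
  *-cancelˡ-< r q m (begin-strict
    r * q           <⟨ m<m+n (r * q) (*-mono-≤ 1≤m 1≤l) ⟩
    r * q + m * l   ≤⟨ +-cancelˡ-≤ (r + l + r * q * m) _ _ key ⟩
    m * r           ≡⟨ *-comm m r ⟩
    r * m           ∎)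
  where
  open ≤-Reasoning
  key : r + l + r * q * m + (r * q + m * l) ≤ r + l + r * q * m + m * r
  key = begin
    r + l + r * q * m + (r * q + m * l) ≡⟨ expand₁ r l q m ⟩
    suc m * (r * q + l) + r             ≡⟨ cong (λ a → suc m * a + r) class-eq ⟩
    suc m * (r + l * n) + r             ≡⟨ expand₂ m r l n ⟩
    suc m * r + l * (suc m * n) + r     ≤⟨ +-monoˡ-≤ r (+-monoʳ-≤ (suc m * r) (*-monoʳ-≤ l m+1*n≤v)) ⟩
    suc m * r + l * v + r               ≡⟨ expand₃ (suc m * r) (l * v) r ⟩
    suc m * r + (r + l * v)             ≡⟨ cong (suc m * r +_) (sym replication-eq) ⟩
    suc m * r + (r * (q * m) + l)       ≡⟨ expand₄ r l q m ⟩
    r + l + r * q * m + m * r           ∎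
    where
    expand₁ : ∀ r l q m → r + l + r * q * m + (r * q + m * l) ≡ suc m * (r * q + l) + r
    expand₁ = solve-∀
    expand₂ : ∀ m r l n → suc m * (r + l * n) + r ≡ suc m * r + l * (suc m * n) + r
    expand₂ = solve-∀
    expand₃ : ∀ a b c → a + b + c ≡ a + (c + b)
    expand₃ = solve-∀
    expand₄ : ∀ r l q m → suc m * r + (r * (q * m) + l) ≡ r + l + r * q * m + m * r
    expand₄ = solve-∀

module ZeroULSE {v k λ' m : ℕ} {ℬ : List (Subset v)} {c : Fin v → Fin (suc m)}
                (bibd : IsBIBD v k λ' ℬ) (ulse : IsZeroULSE v k (suc m) ℬ c) where

  open IsBIBD bibd
  open IsZeroULSE ulse
  open Incidence ℬ
  open ≡-Reasoning

  q : ℕ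
  q = _∣_.quotient divides

  k≡q*m : k ≡ q * m
  k≡q*m = _∣_.equality divides

  k≢0 : k ≢ 0
  k≢0 k≡0 = contradiction (subst (2 ≤_) k≡0 two≤k) λ ()

  1≤q : 1 ≤ q
  1≤q = n≢0⇒n>0 λ q≡0 → k≢0 (trans k≡q*m (cong (_* m) q≡0))

  1≤m : 1 ≤ m
  1≤m = n≢0⇒n>0 λ m≡0 → k≢0 (trans k≡q*m (trans (cong (q *_) m≡0) (*-zeroʳ q)))

  classSize : Fin (suc m) → ℕ
  classSize i = ∑[ y < v ] 𝟙[ c y ≟ i ]

  ∑-classSize : ∑[ i < suc m ] classSize i ≡ v
  ∑-classSize = begin
    ∑[ i < suc m ] ∑[ y < v ] 𝟙[ c y ≟ i ] ≡⟨ ∑-comm (λ i y → 𝟙[ c y ≟ i ]) ⟩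
    ∑[ y < v ] ∑[ i < suc m ] 𝟙[ c y ≟ i ] ≡⟨ sum-cong-≗ (∑-𝟙-≟ ∘ c) ⟩
    ∑[ y < v ] 1                          ≡⟨ ∑-1 v ⟩
    v                                     ∎

  colourCount≡∑ : ∀ B i → colourCount c B i ≡ ∑[ y < v ] (𝟙[ y ∈? B ] * 𝟙[ c y ≟ i ])
  colourCount≡∑ B i = trans (length-filter-tabulate (λ y → (y ∈? B) ×-dec (c y ≟ i)) {v} id)
                            (sum-cong-≗ λ y → 𝟙-×-dec (y ∈? B) (c y ≟ i))

  colourCount-own : ∀ {B x} → B ∈ₗ ℬ → x ∈ B → colourCount c B (c x) ≡ q
  colourCount-own {B} {x} B∈ℬ x∈B with perBlock B∈ℬ
  ... | j , absent , present with c x ≟ j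
  ...   | no  cx≢j = present (c x) cx≢j
  ...   | yes refl = contradiction absent (>⇒≢ (∈-length (∈-filter⁺ _ (∈-allFin x) (x∈B , refl))))

  replication-equation : ∀ x → replication x * k + λ' ≡ replication x + λ' * v
  replication-equation x =
    trans (replication-identity x (balanced x) (λ _ → 1) refl block-weight)
          (cong (λ n → replication x + λ' * n) (∑-1 v))
    where
    block-weight : ∀ j → x ∈ block j → ∑[ y < v ] (𝟙[ y ∈? block j ] * 1) ≡ k
    block-weight j _ = begin
      ∑[ y < v ] (𝟙[ y ∈? block j ] * 1) ≡⟨ sum-cong-≗ (λ y → *-identityʳ 𝟙[ y ∈? block j ]) ⟩
      ∑[ y < v ] 𝟙[ y ∈? block j ]       ≡⟨ sym (∣∣≡∑∈ (block j)) ⟩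
      ∣ block j ∣                         ≡⟨ blockSize (∈-lookup j) ⟩
      k                                  ∎

  class-equation : ∀ x → replication x * q + λ' ≡ replication x + λ' * classSize (c x)
  class-equation x = replication-identity x (balanced x) (λ y → 𝟙[ c y ≟ c x ]) (𝟙-yes (c x ≟ c x) refl)
    λ j x∈B → trans (sym (colourCount≡∑ (block j) (c x))) (colourCount-own (∈-lookup j) x∈B)

  classSize≡1 : q ≡ 1 → ∀ i → classSize i ≡ 1
  classSize≡1 q≡1 i with surjective i
  ... | x , refl = sym (*-cancelˡ-≡ 1 (classSize (c x)) λ' {{>-nonZero λ-positive}}
                         (+-cancelˡ-≡ (replication x) _ _ (begin
    replication x + λ' * 1        ≡⟨ cong₂ _+_ (sym (*-identityʳ (replication x))) (*-identityʳ λ') ⟩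
    replication x * 1 + λ'        ≡⟨ cong (λ a → replication x * a + λ') (sym q≡1) ⟩
    replication x * q + λ'        ≡⟨ class-equation x ⟩
    replication x + λ' * classSize (c x) ∎)))

  2≤q : suc m < v → 2 ≤ q
  2≤q ℓ<v = ≤∧≢⇒< 1≤q λ 1≡q → <⇒≢ ℓ<v (sym (begin
    v                           ≡⟨ sym ∑-classSize ⟩
    ∑[ i < suc m ] classSize i  ≡⟨ sum-cong-≗ (classSize≡1 (sym 1≡q)) ⟩
    ∑[ i < suc m ] 1            ≡⟨ ∑-1 (suc m) ⟩
    suc m                       ∎))

  q<m : q < m
  q<m with ∃-≤-average classSize
  ... | i , ℓ*classSize≤∑ with surjective i
  ... | x , refl = quotient<m 1≤m λ-positive
                     (trans (cong (λ a → replication x * a + λ') (sym k≡q*m)) (replication-equation x))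
                     (class-equation x)
                     (≤-trans ℓ*classSize≤∑ (≤-reflexive ∑-classSize))

colouring-bounds : ∀ {k q m} → k ≡ q * m → 2 ≤ q → q < m →
                   ((3 ≤ 2 * suc m) × (4 * k + 1 ≤ (2 * suc m ∸ 3) ^ 2)) × (2 * suc m ≤ k + 2)
colouring-bounds {q = q} {m = suc n} refl 2≤q (s≤s q≤n) = (3≤2ℓ , square-bound) , linear-bound
  where
  open ≤-Reasoning
  2ℓ≡3+2n+1 : ∀ n → 2 * suc (suc n) ≡ 3 + suc (2 * n)
  2ℓ≡3+2n+1 = solve-∀
  3≤2ℓ : 3 ≤ 2 * suc (suc n)
  3≤2ℓ = subst (3 ≤_) (sym (2ℓ≡3+2n+1 n)) (m≤m+n 3 _)
  odd-square : ∀ n → 4 * (n * suc n) + 1 ≡ suc (2 * n) * (suc (2 * n) * 1)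
  odd-square = solve-∀
  square-bound : 4 * (q * suc n) + 1 ≤ (2 * suc (suc n) ∸ 3) ^ 2
  square-bound = begin
    4 * (q * suc n) + 1       ≤⟨ +-monoˡ-≤ 1 (*-monoʳ-≤ 4 (*-monoˡ-≤ (suc n) q≤n)) ⟩
    4 * (n * suc n) + 1       ≡⟨ odd-square n ⟩
    suc (2 * n) ^ 2           ≡⟨ cong (_^ 2) (sym (trans (cong (_∸ 3) (2ℓ≡3+2n+1 n)) (m+n∸m≡n 3 _))) ⟩
    (2 * suc (suc n) ∸ 3) ^ 2 ∎
  2ℓ≡2m+2 : ∀ n → 2 * suc (suc n) ≡ 2 * suc n + 2
  2ℓ≡2m+2 = solve-∀
  linear-bound : 2 * suc (suc n) ≤ q * suc n + 2
  linear-bound = begin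
    2 * suc (suc n)  ≡⟨ 2ℓ≡2m+2 n ⟩
    2 * suc n + 2    ≤⟨ +-monoˡ-≤ 2 (*-monoˡ-≤ (suc n) 2≤q) ⟩
    q * suc n + 2    ∎

theorem3p7 : ∀ (v k λ' ℓ : ℕ) (ℬ : List (Subset v)) (c : Fin v → Fin ℓ) →
    IsBIBD v k λ' ℬ → IsZeroULSE v k ℓ ℬ c → ℓ < v →
    ((3 ≤ 2 * ℓ) × (4 * k + 1 ≤ (2 * ℓ ∸ 3) ^ 2)) × (2 * ℓ ≤ k + 2)
theorem3p7 zero    k λ' ℓ       ℬ c bibd _    _   = contradiction (IsBIBD.k<v bibd) λ ()
theorem3p7 (suc v) k λ' zero    ℬ c _    _    _   with c fzero
... | ()
theorem3p7 v       k λ' (suc m) ℬ c bibd ulse ℓ<v = colouring-bounds k≡q*m (2≤q ℓ<v) q<m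
  where open ZeroULSE bibd ulse
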